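{- Consider a red/blue coloring of the vertices of the grid $\boxplus_{m\times n}$ that contains no cross-structure. Suppose $a,w_1,w_2,b$ are four consecutive vertices in a row or in a column of the grid, with $a,b$ red and $w_1,w_2$ blue. Suppose further that $a$ and $b$ belong to different red regions, at least one of which is an island. Then: - $\{w_1,w_2\}$ is a disposable set for its blue region; - recoloring both $w_1$ and $w_2$ red creates no cross-structure; - recoloring both $w_1$ and $w_2$ red does not increase the degree of the outer-face dual vertex $v_0^*$.
   Context: Colorings and regions. - $\boxplus_{m\times n}$ is the $m\times n$ grid graph with its standard planar embedding. - A coloring assigns red or blue to each vertex. - A region is a maximal connected set of same-colored vertices. - An island is a region none of whose vertices lies on the outer boundary of the grid. - A set $R'\subseteq R$ of vertices of a region $R$ is disposable if $R\setminus R'$ is empty or induces a connected subgraph. - A cross-structure is a unit square of four vertices $(i,j),(i+1,j),(i,j+1),(i+1,j+1)$ in which $(i,j),(i+1,j+1)$ have one color and $(i+1,j),(i,j+1)$ have the other. Degree of the outer-face vertex. - $v_0^*$ is the vertex of the planar dual corresponding to the outer face. - For a coloring, the degree of $v_0^*$ is the number of dual edges incident to $v_0^*$ whose primal edges have endpoints of different colors. - Equivalently, it is the number of bichromatic primal edges on the outer face boundary of the grid. -}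

module Defs where

open import Data.Nat using (ℕ; zero; suc; _+_; _≤_)
import Data.Nat
open import Data.Fin using (Fin; toℕ; fromℕ)
import Data.Fin as F
open import Data.Product using (_×_; _,_; Σ; ∃)
open import Data.Sum using (_⊎_)
open import Relation.Binary.PropositionalEquality using (_≡_; _≢_)
open import Relation.Nullary using (¬_; yes; no)
open import Data.Empty using (⊥)

data Color : Set where
  red blue : Color

_≟c_ : (x y : Color) → Relation.Nullary.Dec (x ≡ y)
red  ≟c red  = yes _≡_.refl
red  ≟c blue = no λ ()
blue ≟c red  = no λ ()
blue ≟c blue = yes _≡_.refl

V : ℕ → ℕ → Set
V m n = Fin m × Fin n

row : ∀ {m n} → V m n → ℕ
row (i , _) = toℕ i

col : ∀ {m n} → V m n → ℕ
col (_ , j) = toℕ j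

Coloring : ℕ → ℕ → Set
Coloring m n = V m n → Color

Adj : ∀ {m n} → V m n → V m n → Set
Adj u v =
  (row u ≡ row v × (suc (col u) ≡ col v ⊎ suc (col v) ≡ col u))
  ⊎ (col u ≡ col v × (suc (row u) ≡ row v ⊎ suc (row v) ≡ row u))

data Reach {m n} (S : V m n → Set) : V m n → V m n → Set where
  here : ∀ {u} → S u → Reach S u u
  step : ∀ {u v w} → S u → Adj u v → Reach S v w → Reach S u w

Region : ∀ {m n} → Coloring m n → V m n → V m n → Set
Region c v u = Reach (λ x → c x ≡ c v) v u

OnBoundary : ∀ {m n} → V m n → Set
OnBoundary {m} {n} u =
  row u ≡ 0 ⊎ suc (row u) ≡ m ⊎ col u ≡ 0 ⊎ suc (col u) ≡ n

IsIsland : ∀ {m n} → Coloring m n → V m n → Set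
IsIsland c v = ∀ u → Region c v u → ¬ OnBoundary u

Disposable : ∀ {m n} → (R R' : V m n → Set) → Set
Disposable R R' =
  (∀ u → R' u → R u) ×
  ((∀ u → R u → ¬ R' u → ⊥)
   ⊎ (∀ u v → (R u × ¬ R' u) → (R v × ¬ R' v)
         → Reach (λ x → R x × ¬ R' x) u v))

HasCross : ∀ {m n} → Coloring m n → Set
HasCross {m} {n} c =
  Σ (V m n) λ p → Σ (V m n) λ q → Σ (V m n) λ r → Σ (V m n) λ s →
    (row q ≡ suc (row p) × col q ≡ col p) ×
    (row r ≡ row p × col r ≡ suc (col p)) ×
    (row s ≡ suc (row p) × col s ≡ suc (col p)) ×
    c p ≡ c s × c q ≡ c r × c p ≢ c q

bichrom : Color → Color → ℕ
bichrom x y with x ≟c y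
... | yes _ = 0
... | no  _ = 1

lineDiffs : ∀ {k} → (Fin k → Color) → ℕ
lineDiffs {zero} f = 0
lineDiffs {suc zero} f = 0
lineDiffs {suc (suc k)} f = bichrom (f F.zero) (f (F.suc F.zero)) + lineDiffs (λ x → f (F.suc x))

-- Degree of the outer-face dual vertex v0*: number of bichromatic edges
-- on the outer face boundary (top row, bottom row, left column, right
-- column).  For degenerate grids (m = 1 or n = 1) each edge is a bridge
-- whose dual edge is a loop at v0*, counted twice, which this formula does.
degOuter : ∀ {m n} → Coloring m n → ℕ
degOuter {zero} {n} c = 0
degOuter {suc m} {zero} c = 0
degOuter {suc m} {suc n} c =
  lineDiffs (λ j → c (F.zero , j)) + lineDiffs (λ j → c (fromℕ m , j)) +
  lineDiffs (λ i → c (i , F.zero)) + lineDiffs (λ i → c (i , fromℕ n))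

recolorRed : ∀ {m n} → Coloring m n → V m n → V m n → Coloring m n
recolorRed c w₁ w₂ u with row u Data.Nat.≟ row w₁ | col u Data.Nat.≟ col w₁
                        | row u Data.Nat.≟ row w₂ | col u Data.Nat.≟ col w₂
... | yes _ | yes _ | _     | _     = red
... | _     | _     | yes _ | yes _ = red
... | _     | _     | _     | _     = c u

Consecutive4 : ∀ {m n} → V m n → V m n → V m n → V m n → Set
Consecutive4 a w₁ w₂ b =
  (row w₁ ≡ row a × row w₂ ≡ row a × row b ≡ row a ×
   col w₁ ≡ 1 + col a × col w₂ ≡ 2 + col a × col b ≡ 3 + col a)
  ⊎ (col w₁ ≡ col a × col w₂ ≡ col a × col b ≡ col a ×
   row w₁ ≡ 1 + row a × row w₂ ≡ 2 + row a × row b ≡ 3 + row a)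

module Submission where

-- Say the red region A of a is the island (otherwise exchange a, w₁ with b, w₂).  In coordinates
-- where a is the origin and the line a w₁ w₂ b runs east, trace the contour of A counterclockwise as
-- a sequence of edges from a cell of A to a blue neighbor.  Without cross-structures consecutive
-- blue cells along the contour are adjacent, and tracing is injective on a finite set, so the contour
-- leaving a towards w₁ comes back to that edge.  In between it reaches w₁ again only from below and
-- never reaches w₂, no neighbor of which lies in A since b does not; this gives a blue path avoiding
-- w₁ and w₂ from a cell above them to a cell below them.  A blue path from any other cell of the
-- region of w₁ enters {w₁, w₂} from one of these four cells, so removing w₁ and w₂ keeps the region
-- connected.  Recoloring creates no cross-structure because every unit square at w₁ or w₂ contains
-- a red neighbor of it along the line, and it leaves the outer boundary unchanged because w₁ and w₂
-- are interior.

open import Defs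
open import Data.Nat using (_≤_)
open import Data.Product using (_×_)
open import Data.Sum using (_⊎_)
open import Relation.Binary.PropositionalEquality using (_≡_)
open import Relation.Nullary using (¬_)

open import Data.Nat as ℕ using (ℕ; zero; suc)
import Data.Nat.Properties as ℕ
open import Data.Nat.GeneralisedArithmetic using (iterate)
open import Data.Integer as ℤ using (ℤ; +_; -[1+_])
import Data.Integer.Properties as ℤ
open import Data.Fin as Fin using (Fin; toℕ; fromℕ<)
import Data.Fin.Properties as Fin
open import Data.Product using (Σ; ∃; _,_; proj₁; proj₂; map₂)
open import Data.Product.Properties using (,-injective; ≡-dec)
open import Data.Sum using (inj₁; inj₂; [_,_]′; swap)
open import Function using (_∘_)
open import Data.Empty using (⊥; ⊥-elim)
open import Relation.Nullary using (Dec; yes; no)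
open import Relation.Nullary.Decidable using (_⊎-dec_)
open import Relation.Unary using (Decidable)
open import Relation.Binary.PropositionalEquality
open import Algebra.Properties.AbelianGroup ℤ.+-0-abelianGroup using (∙-cancelʳ)

module _ {A : Set} (f : A → A) where

  iterate-commute : ∀ x k → iterate f (f x) k ≡ f (iterate f x k)
  iterate-commute x zero    = refl
  iterate-commute x (suc k) = iterate-commute (f x) k

  iterate-fixed : ∀ {x} → f x ≡ x → ∀ k → iterate f x k ≡ x
  iterate-fixed fx≡x zero    = refl
  iterate-fixed fx≡x (suc k) = trans (cong (λ y → iterate f y k) fx≡x) (iterate-fixed fx≡x k)

  iterate-injective : (∀ {x y} → f x ≡ f y → x ≡ y) → ∀ k {x y} → iterate f x k ≡ iterate f y k → x ≡ y
  iterate-injective inj zero    eq = eq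
  iterate-injective inj (suc k) eq = inj (iterate-injective inj k eq)

  iterate-surjective : (∀ y → ∃ λ x → f x ≡ y) → ∀ k y → ∃ λ x → iterate f x k ≡ y
  iterate-surjective surj zero    y = y , refl
  iterate-surjective surj (suc k) y with iterate-surjective surj k y
  ... | x′ , eq with surj x′
  ...   | x , refl = x , eq

  module _ {P : A → Set} (f-preserves : ∀ {x} → P x → P (f x))
           (g : A → A) (g-f : ∀ {x} → P x → g (f x) ≡ x) where

    iterate-preserves : ∀ {x} → P x → ∀ k → P (iterate f x k)
    iterate-preserves px zero    = px
    iterate-preserves px (suc k) = iterate-preserves (f-preserves px) k

    iterate-repeat⇒periodic : ∀ {x} → P x → ∀ i j → i ℕ.< j → iterate f x i ≡ iterate f x j
                            → ∃ λ k → iterate f x (suc k) ≡ x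
    iterate-repeat⇒periodic px zero    (suc k) _         eq = k , sym eq
    iterate-repeat⇒periodic {x} px (suc i) (suc j) (ℕ.s≤s i<j) eq =
      iterate-repeat⇒periodic px i j i<j (begin
        iterate f x i           ≡⟨ g-f (iterate-preserves px i) ⟨
        g (f (iterate f x i))   ≡⟨ cong g (iterate-commute x i) ⟨
        g (iterate f x (suc i)) ≡⟨ cong g eq ⟩
        g (iterate f x (suc j)) ≡⟨ cong g (iterate-commute x j) ⟩
        g (f (iterate f x j))   ≡⟨ g-f (iterate-preserves px j) ⟩
        iterate f x j           ∎)
      where open ≡-Reasoning

    periodic : ∀ {K} (index : ∀ {x} → P x → Fin K)
             → (∀ {x y} (px : P x) (py : P y) → index px ≡ index py → x ≡ y)
             → ∀ {x} → P x → ∃ λ k → iterate f x (suc k) ≡ x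
    periodic index index-injective {x} px
      with Fin.pigeonhole (ℕ.n<1+n _) (λ i → index (iterate-preserves px (toℕ i)))
    ... | i , j , i<j , same = iterate-repeat⇒periodic px (toℕ i) (toℕ j) i<j
                                 (index-injective _ _ same)

Point : Set
Point = ℤ × ℤ

data Dir : Set where
  E N W S : Dir

-- Points are (row , column) and rows grow southwards, as in the grid.
move : Dir → Point → Point
move E (x , y) = x , ℤ.suc y
move N (x , y) = ℤ.pred x , y
move W (x , y) = x , ℤ.pred y
move S (x , y) = ℤ.suc x , y

rot rot⁻¹ opp : Dir → Dir
rot E = N
rot N = W
rot W = S
rot S = E
rot⁻¹ E = S
rot⁻¹ N = E
rot⁻¹ W = N
rot⁻¹ S = W
opp E = W
opp N = S
opp W = E
opp S = N

rot-rot⁻¹ : ∀ d → rot (rot⁻¹ d) ≡ d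
rot-rot⁻¹ E = refl
rot-rot⁻¹ N = refl
rot-rot⁻¹ W = refl
rot-rot⁻¹ S = refl

rot⁻¹-rot : ∀ d → rot⁻¹ (rot d) ≡ d
rot⁻¹-rot E = refl
rot⁻¹-rot N = refl
rot⁻¹-rot W = refl
rot⁻¹-rot S = refl

rot⁻¹≡opp-rot : ∀ d → rot⁻¹ d ≡ opp (rot d)
rot⁻¹≡opp-rot E = refl
rot⁻¹≡opp-rot N = refl
rot⁻¹≡opp-rot W = refl
rot⁻¹≡opp-rot S = refl

rot⁻¹-opp-rot : ∀ d → rot⁻¹ (opp (rot d)) ≡ opp d
rot⁻¹-opp-rot E = refl
rot⁻¹-opp-rot N = refl
rot⁻¹-opp-rot W = refl
rot⁻¹-opp-rot S = refl

opp-involutive : ∀ d → opp (opp d) ≡ d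
opp-involutive E = refl
opp-involutive N = refl
opp-involutive W = refl
opp-involutive S = refl

dirIndex : Dir → Fin 4
dirIndex E = Fin.zero
dirIndex N = Fin.suc Fin.zero
dirIndex W = Fin.suc (Fin.suc Fin.zero)
dirIndex S = Fin.suc (Fin.suc (Fin.suc Fin.zero))

indexDir : Fin 4 → Dir
indexDir Fin.zero                               = E
indexDir (Fin.suc Fin.zero)                     = N
indexDir (Fin.suc (Fin.suc Fin.zero))           = W
indexDir (Fin.suc (Fin.suc (Fin.suc Fin.zero))) = S

indexDir-dirIndex : ∀ d → indexDir (dirIndex d) ≡ d
indexDir-dirIndex E = refl
indexDir-dirIndex N = refl
indexDir-dirIndex W = refl
indexDir-dirIndex S = refl

dirIndex-injective : ∀ {d e} → dirIndex d ≡ dirIndex e → d ≡ e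
dirIndex-injective {d} {e} eq =
  trans (sym (indexDir-dirIndex d)) (trans (cong indexDir eq) (indexDir-dirIndex e))

move-opp : ∀ d z → move (opp d) (move d z) ≡ z
move-opp E (x , y) = cong (x ,_) (ℤ.pred-suc y)
move-opp N (x , y) = cong (_, y) (ℤ.suc-pred x)
move-opp W (x , y) = cong (x ,_) (ℤ.suc-pred y)
move-opp S (x , y) = cong (_, y) (ℤ.pred-suc x)

move⁻¹ : ∀ d {u z} → move d u ≡ z → u ≡ move (opp d) z
move⁻¹ d {u} refl = sym (move-opp d u)

suc-pred-comm : ∀ x → ℤ.suc (ℤ.pred x) ≡ ℤ.pred (ℤ.suc x)
suc-pred-comm x = trans (ℤ.suc-pred x) (sym (ℤ.pred-suc x))

move-comm : ∀ d e z → move d (move e z) ≡ move e (move d z)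
move-comm E E z       = refl
move-comm E N z       = refl
move-comm E W (x , y) = cong (x ,_) (suc-pred-comm y)
move-comm E S z       = refl
move-comm N E z       = refl
move-comm N N z       = refl
move-comm N W z       = refl
move-comm N S (x , y) = cong (_, y) (sym (suc-pred-comm x))
move-comm W E (x , y) = cong (x ,_) (sym (suc-pred-comm y))
move-comm W N z       = refl
move-comm W W z       = refl
move-comm W S z       = refl
move-comm S E z       = refl
move-comm S N (x , y) = cong (_, y) (suc-pred-comm x)
move-comm S W z       = refl
move-comm S S z       = refl

rotate : Point → Point
rotate (x , y) = ℤ.- y , x

translate : Point → Point → Point
translate (p , q) (x , y) = x ℤ.+ p , y ℤ.+ q

rotate-move : ∀ d z → rotate (move d z) ≡ move (rot d) (rotate z)
rotate-move E (x , y) = cong (_, x) (ℤ.neg-distrib-+ (+ 1) y)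
rotate-move N (x , y) = refl
rotate-move W (x , y) = cong (_, x) (ℤ.neg-distrib-+ -[1+ 0 ] y)
rotate-move S (x , y) = refl

rotate-injective : ∀ {z z′} → rotate z ≡ rotate z′ → z ≡ z′
rotate-injective eq with ,-injective eq
... | -y≡-y′ , refl = cong (_ ,_) (ℤ.neg-injective -y≡-y′)

translate-move : ∀ o d z → translate o (move d z) ≡ move d (translate o z)
translate-move (p , q) E (x , y) = cong (_ ,_) (ℤ.+-assoc (+ 1) y q)
translate-move (p , q) N (x , y) = cong (_, _) (ℤ.pred-+ x p)
translate-move (p , q) W (x , y) = cong (_ ,_) (ℤ.pred-+ y q)
translate-move (p , q) S (x , y) = cong (_, _) (ℤ.+-assoc (+ 1) x p)

translate-injective : ∀ o {z z′} → translate o z ≡ translate o z′ → z ≡ z′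
translate-injective (p , q) {x , y} {x′ , y′} eq with ,-injective eq
... | ex , ey = cong₂ _,_ (∙-cancelʳ p x x′ ex) (∙-cancelʳ q y y′ ey)

translate-origin : ∀ o → translate o (+ 0 , + 0) ≡ o
translate-origin (p , q) = cong₂ _,_ (ℤ.+-identityˡ p) (ℤ.+-identityˡ q)

turns : Dir → ℕ
turns E = 0
turns N = 1
turns W = 2
turns S = 3

-- The rigid motion of the plane taking the origin to o and the direction E to D.
frame : Dir → Point → Point → Point
frame D o z = translate o (iterate rotate z (turns D))

turn : Dir → Dir → Dir
turn D d = iterate rot d (turns D)

turn-E : ∀ D → turn D E ≡ D
turn-E E = refl
turn-E N = refl
turn-E W = refl
turn-E S = refl

turn-rot : ∀ D d → turn D (rot d) ≡ rot (turn D d)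
turn-rot D d = iterate-commute rot d (turns D)

turn-surjective : ∀ D e → ∃ λ d → turn D d ≡ e
turn-surjective D = iterate-surjective rot (λ e → rot⁻¹ e , rot-rot⁻¹ e) (turns D)

iterate-rotate-move : ∀ k d z → iterate rotate (move d z) k ≡ move (iterate rot d k) (iterate rotate z k)
iterate-rotate-move zero    d z = refl
iterate-rotate-move (suc k) d z =
  trans (cong (λ p → iterate rotate p k) (rotate-move d z)) (iterate-rotate-move k (rot d) (rotate z))

frame-move : ∀ D o d z → frame D o (move d z) ≡ move (turn D d) (frame D o z)
frame-move D o d z =
  trans (cong (translate o) (iterate-rotate-move (turns D) d z)) (translate-move o (turn D d) _)

frame-injective : ∀ D o {z z′} → frame D o z ≡ frame D o z′ → z ≡ z′
frame-injective D o eq = iterate-injective rotate rotate-injective (turns D) (translate-injective o eq)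

frame-origin : ∀ D o → frame D o (+ 0 , + 0) ≡ o
frame-origin D o = trans (cong (translate o) (iterate-fixed rotate refl (turns D))) (translate-origin o)

Near1 : ℤ → ℤ → Set
Near1 x x′ = x′ ≡ ℤ.pred x ⊎ x′ ≡ x ⊎ x′ ≡ ℤ.suc x

Box : Point → Point → Set
Box (x , y) (x′ , y′) = Near1 x x′ × Near1 y y′

move-box : ∀ d p → Box p (move d p)
move-box E _ = inj₂ (inj₁ refl) , inj₂ (inj₂ refl)
move-box N _ = inj₁ refl        , inj₂ (inj₁ refl)
move-box W _ = inj₂ (inj₁ refl) , inj₁ refl
move-box S _ = inj₂ (inj₂ refl) , inj₂ (inj₁ refl)

diagonal-box : ∀ d p → Box p (move (rot d) (move d p))
diagonal-box E _ = inj₁ refl        , inj₂ (inj₂ refl)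
diagonal-box N _ = inj₁ refl        , inj₁ refl
diagonal-box W _ = inj₂ (inj₂ refl) , inj₁ refl
diagonal-box S _ = inj₂ (inj₂ refl) , inj₂ (inj₂ refl)

data Walk (P : Point → Set) : Point → Point → Set where
  here : ∀ {z} → P z → Walk P z z
  step : ∀ {z z₁ z₂} → P z → (d : Dir) → move d z ≡ z₁ → Walk P z₁ z₂ → Walk P z z₂

_++ʷ_ : ∀ {P x y z} → Walk P x y → Walk P y z → Walk P x z
here _         ++ʷ w′ = w′
step p d eq w  ++ʷ w′ = step p d eq (w ++ʷ w′)

walk-head : ∀ {P z z′} → Walk P z z′ → P z
walk-head (here p)       = p
walk-head (step p _ _ _) = p

walk-last : ∀ {P z z′} → Walk P z z′ → P z′
walk-last (here p)       = p
walk-last (step _ _ _ w) = walk-last w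

-- In local coordinates a, w₁, w₂, b are onLine 0, 1, 2, 3.
onLine above below : ℕ → Point
onLine i = + 0 , + i
above  i = -[1+ 0 ] , + i
below  i = + 1 , + i

Flank : ℤ → Point → Set
Flank r z = z ≡ (r , + 1) ⊎ z ≡ (r , + 2)

Top Bottom : Point → Set
Top    = Flank -[1+ 0 ]
Bottom = Flank (+ 1)

Flank-close : ∀ {r z z′} → Flank r z → Flank r z′ → z ≡ z′ ⊎ ∃ λ d → z′ ≡ move d z
Flank-close (inj₁ refl) (inj₁ refl) = inj₁ refl
Flank-close (inj₁ refl) (inj₂ refl) = inj₂ (E , refl)
Flank-close (inj₂ refl) (inj₁ refl) = inj₂ (W , refl)
Flank-close (inj₂ refl) (inj₂ refl) = inj₁ refl

module Contour
  (L : Point → Color) (A : Point → Set)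
  (A-red : ∀ {z} → A z → L z ≡ red)
  (A-closed : ∀ {z} d → A z → L (move d z) ≡ red → A (move d z))
  (cross-free : ∀ {z} d → A z → L (move d z) ≡ blue → L (move (rot d) z) ≡ blue
              → L (move (rot d) (move d z)) ≡ blue)
  where

  -- (u , d) stands for the unit edge between the cell u of A and its blue neighbor u + d.
  Edge : Set
  Edge = Point × Dir

  OnContour : Edge → Set
  OnContour (u , d) = A u × L (move d u) ≡ blue

  target : Edge → Point
  target (u , d) = move d u

  -- Walking around A with A on the left, r = rot gives the next edge and r = rot⁻¹ the previous one.
  followBy : (Dir → Dir) → Color → Color → Edge → Edge
  followBy r blue _    (u , d) = u , r d
  followBy r red  blue (u , d) = move (r d) u , d
  followBy r red  red  (u , d) = move (r d) (move d u) , opp (r d)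

  follow : (Dir → Dir) → Edge → Edge
  follow r (u , d) = followBy r (L (move (r d) u)) (L (move (r d) (move d u))) (u , d)

  next prev : Edge → Edge
  next = follow rot
  prev = follow rot⁻¹

  module _ (r : Dir → Dir) {u : Point} {d : Dir} where

    follow-turn : L (move (r d) u) ≡ blue → follow r (u , d) ≡ (u , r d)
    follow-turn eq = cong (λ k → followBy r k (L (move (r d) (move d u))) (u , d)) eq

    follow-straight : L (move (r d) u) ≡ red → L (move (r d) (move d u)) ≡ blue
                    → follow r (u , d) ≡ (move (r d) u , d)
    follow-straight eq eq′ = cong₂ (λ k k′ → followBy r k k′ (u , d)) eq eq′

    follow-corner : L (move (r d) u) ≡ red → L (move (r d) (move d u)) ≡ red
                  → follow r (u , d) ≡ (move (r d) (move d u) , opp (r d))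
    follow-corner eq eq′ = cong₂ (λ k k′ → followBy r k k′ (u , d)) eq eq′

  next-onContour : ∀ {e} → OnContour e → OnContour (next e)
  next-onContour {u , d} (u∈A , t-blue) with L (move (rot d) u) in side | L (move (rot d) (move d u)) in corner
  ... | blue | _    = u∈A , side
  ... | red  | blue = A-closed (rot d) u∈A side , trans (cong L (move-comm d (rot d) u)) corner
  ... | red  | red  =
    subst A (move-comm d (rot d) u)
      (A-closed d (A-closed (rot d) u∈A side) (trans (cong L (move-comm d (rot d) u)) corner)) ,
    trans (cong L (move-opp (rot d) (move d u))) t-blue

  prev-next : ∀ {u d} → L u ≡ red → L (move d u) ≡ blue → prev (next (u , d)) ≡ (u , d)
  prev-next {u} {d} u-red t-blue with L (move (rot d) u) in side | L (move (rot d) (move d u)) in corner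
  ... | blue | _ =
    trans (follow-turn rot⁻¹ (subst (λ k → L (move k u) ≡ blue) (sym (rot⁻¹-rot d)) t-blue))
          (cong (u ,_) (rot⁻¹-rot d))
  ... | red | blue =
    trans (follow-straight rot⁻¹ (trans (cong L back) u-red) (trans (cong L back′) t-blue)) (cong (_, d) back)
    where
    undo : ∀ z → move (rot⁻¹ d) (move (rot d) z) ≡ z
    undo z = trans (cong (λ k → move k (move (rot d) z)) (rot⁻¹≡opp-rot d)) (move-opp (rot d) z)
    back : move (rot⁻¹ d) (move (rot d) u) ≡ u
    back = undo u
    back′ : move (rot⁻¹ d) (move d (move (rot d) u)) ≡ move d u
    back′ = trans (cong (move (rot⁻¹ d)) (move-comm d (rot d) u)) (undo (move d u))
  ... | red | red =
    trans (follow-corner rot⁻¹ (trans (cong L back) side) (trans (cong L back′) u-red))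
          (cong₂ _,_ back′ (trans (cong opp (rot⁻¹-opp-rot d)) (opp-involutive d)))
    where
    reverse : ∀ z → move (rot⁻¹ (opp (rot d))) z ≡ move (opp d) z
    reverse z = cong (λ k → move k z) (rot⁻¹-opp-rot d)
    back : move (rot⁻¹ (opp (rot d))) (move (rot d) (move d u)) ≡ move (rot d) u
    back = trans (reverse _) (trans (move-comm (opp d) (rot d) (move d u)) (cong (move (rot d)) (move-opp d u)))
    back′ : move (rot⁻¹ (opp (rot d))) (move (opp (rot d)) (move (rot d) (move d u))) ≡ u
    back′ = trans (reverse _) (trans (cong (move (opp d)) (move-opp (rot d) (move d u))) (move-opp d u))

  prev-next-onContour : ∀ {e} → OnContour e → prev (next e) ≡ e
  prev-next-onContour (u∈A , t-blue) = prev-next (A-red u∈A) t-blue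

  next-periodic : ∀ {K} (index : ∀ {z} → A z → Fin K)
                → (∀ {z z′} (p : A z) (p′ : A z′) → index p ≡ index p′ → z ≡ z′)
                → ∀ {e} → OnContour e → ∃ λ k → iterate next e (suc k) ≡ e
  next-periodic index index-injective =
    periodic next next-onContour prev prev-next-onContour edgeIndex edgeIndex-injective
    where
    edgeIndex : ∀ {e} → OnContour e → Fin _
    edgeIndex {u , d} (u∈A , _) = Fin.combine (index u∈A) (dirIndex d)
    edgeIndex-injective : ∀ {e e′} (p : OnContour e) (p′ : OnContour e′)
                        → edgeIndex p ≡ edgeIndex p′ → e ≡ e′
    edgeIndex-injective {u , d} {u′ , d′} (u∈A , _) (u′∈A , _) eq
      with Fin.combine-injective (index u∈A) (dirIndex d) (index u′∈A) (dirIndex d′) eq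
    ... | same-cell , same-dir = cong₂ _,_ (index-injective u∈A u′∈A same-cell) (dirIndex-injective same-dir)

  NearA : Point → Set
  NearA z = Σ Point λ u → A u × Σ Dir λ d → z ≡ move d u ⊎ z ≡ move (rot d) (move d u)

  walk-next : (P : Point → Set) → ∀ {u d} → P (move d u) → P (target (next (u , d)))
            → (L (move (rot d) u) ≡ blue → P (move (rot d) (move d u)))
            → Walk P (move d u) (target (next (u , d)))
  walk-next P {u} {d} P-target P-target′ P-corner
    with L (move (rot d) u) | L (move (rot d) (move d u))
  ... | blue | _ = step P-target (rot d) refl (step (P-corner refl) (opp d) corner→side (here P-target′))
    where
    corner→side : move (opp d) (move (rot d) (move d u)) ≡ move (rot d) u
    corner→side = trans (move-comm (opp d) (rot d) (move d u)) (cong (move (rot d)) (move-opp d u))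
  ... | red | blue = step P-target (rot d) (move-comm (rot d) d u) (here P-target′)
  ... | red | red  = subst (Walk P (move d u)) (sym (move-opp (rot d) (move d u))) (here P-target)

  module Separation
    {K : ℕ} (index : ∀ {z} → A z → Fin K)
    (index-injective : ∀ {z z′} (p : A z) (p′ : A z′) → index p ≡ index p′ → z ≡ z′)
    (a∈A : A (onLine 0)) (w₁-blue : L (onLine 1) ≡ blue) (w₂-blue : L (onLine 2) ≡ blue)
    (b-red : L (onLine 3) ≡ red) (b∉A : ¬ A (onLine 3))
    where

    clash : ∀ {z} → L z ≡ red → L z ≡ blue → ⊥
    clash z-red z-blue with () ← trans (sym z-red) z-blue

    blue∉A : ∀ {z} → L z ≡ blue → ¬ A z
    blue∉A z-blue z∈A = clash (A-red z∈A) z-blue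

    above₂∉A : ¬ A (above 2)
    above₂∉A p with L (above 3) in eq
    ... | blue = clash b-red (cross-free S p w₂-blue eq)
    ... | red  = b∉A (A-closed S (A-closed E p eq) b-red)

    below₂∉A : ¬ A (below 2)
    below₂∉A p with L (below 3) in eq
    ... | blue = clash b-red (cross-free E p eq w₂-blue)
    ... | red  = b∉A (A-closed N (A-closed E p eq) b-red)

    above₀-red : L (above 1) ≡ red → L (above 0) ≡ red
    above₀-red above₁-red with L (above 0) in eq
    ... | red  = refl
    ... | blue = ⊥-elim (clash above₁-red (cross-free E a∈A w₁-blue eq))

    below₀-red : L (below 1) ≡ red → L (below 0) ≡ red
    below₀-red below₁-red with L (below 0) in eq
    ... | red  = refl
    ... | blue = ⊥-elim (clash below₁-red (cross-free S a∈A eq w₁-blue))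

    IntoW₁ : Edge → Set
    IntoW₁ e = target e ≡ onLine 1

    intoW₁? : ∀ e → Dec (IntoW₁ e)
    intoW₁? e = ≡-dec ℤ._≟_ ℤ._≟_ (target e) (onLine 1)

    e₀ : Edge
    e₀ = onLine 0 , E

    edges-into-w₁ : ∀ {e} → OnContour e → IntoW₁ e
                  → e ≡ e₀ ⊎ e ≡ (above 1 , S) ⊎ e ≡ (below 1 , N)
    edges-into-w₁ {u , E} _          into with refl ← move⁻¹ E {u} into = inj₁ refl
    edges-into-w₁ {u , N} _          into with refl ← move⁻¹ N {u} into = inj₂ (inj₂ refl)
    edges-into-w₁ {u , W} (u∈A , _) into with refl ← move⁻¹ W {u} into = ⊥-elim (blue∉A w₂-blue u∈A)
    edges-into-w₁ {u , S} _          into with refl ← move⁻¹ S {u} into = inj₂ (inj₁ refl)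

    target≢w₂ : ∀ {e} → OnContour e → target e ≢ onLine 2
    target≢w₂ {u , E} (u∈A , _) eq with refl ← move⁻¹ E {u} eq = blue∉A w₁-blue u∈A
    target≢w₂ {u , N} (u∈A , _) eq with refl ← move⁻¹ N {u} eq = below₂∉A u∈A
    target≢w₂ {u , W} (u∈A , _) eq with refl ← move⁻¹ W {u} eq = b∉A u∈A
    target≢w₂ {u , S} (u∈A , _) eq with refl ← move⁻¹ S {u} eq = above₂∉A u∈A

    module _ {u : Point} (u∈A : A u) where

      corner≢w₁ : ∀ d → L (move d u) ≡ blue → L (move (rot d) u) ≡ blue → move (rot d) (move d u) ≢ onLine 1
      corner≢w₁ E _      side-blue eq with refl ← move⁻¹ E {u} (move⁻¹ N eq) = clash (A-red a∈A) side-blue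
      corner≢w₁ N _      _         eq with refl ← move⁻¹ N {u} (move⁻¹ W eq) = below₂∉A u∈A
      corner≢w₁ W _      _         eq with refl ← move⁻¹ W {u} (move⁻¹ S eq) = above₂∉A u∈A
      corner≢w₁ S t-blue _         eq with refl ← move⁻¹ S {u} (move⁻¹ E eq) = clash (A-red a∈A) t-blue

      corner≢w₂ : ∀ d → L (move d u) ≡ blue → L (move (rot d) u) ≡ blue
                → ¬ IntoW₁ (u , d) → ¬ IntoW₁ (u , rot d) → move (rot d) (move d u) ≢ onLine 2
      corner≢w₂ E _      _         _  away′ eq with refl ← move⁻¹ E {u} (move⁻¹ N eq) = away′ refl
      corner≢w₂ N t-blue _         _  _   eq with refl ← move⁻¹ N {u} (move⁻¹ W eq) = clash b-red t-blue
      corner≢w₂ W _      side-blue _  _   eq with refl ← move⁻¹ W {u} (move⁻¹ S eq) = clash b-red side-blue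
      corner≢w₂ S _      _         away _   eq with refl ← move⁻¹ S {u} (move⁻¹ E eq) = away refl

    Shore : Point → Set
    Shore z = L z ≡ blue × z ≢ onLine 1 × z ≢ onLine 2 × NearA z

    target-shore : ∀ {e} → OnContour e → ¬ IntoW₁ e → Shore (target e)
    target-shore {u , d} on@(u∈A , t-blue) away = t-blue , away , target≢w₂ on , u , u∈A , d , inj₁ refl

    walk-step : ∀ {e} → OnContour e → ¬ IntoW₁ e → ¬ IntoW₁ (next e) → Walk Shore (target e) (target (next e))
    walk-step {u , d} on@(u∈A , t-blue) away away′ =
      walk-next Shore (target-shore on away) (target-shore (next-onContour on) away′) corner-shore
      where
      corner-shore : L (move (rot d) u) ≡ blue → Shore (move (rot d) (move d u))
      corner-shore side-blue =
        cross-free d u∈A t-blue side-blue ,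
        corner≢w₁ u∈A d t-blue side-blue ,
        corner≢w₂ u∈A d t-blue side-blue away (subst (λ e → ¬ IntoW₁ e) (follow-turn rot side-blue) away′) ,
        u , u∈A , d , inj₂ refl

    prev-of : ∀ {e e′} → OnContour e → next e ≡ e′ → e ≡ prev e′
    prev-of on refl = sym (prev-next-onContour on)

    -- Only e₀ precedes the edge (above 1 , S) into w₁, so the contour comes back to w₁ from below.
    walk-to-bottom-from : ∀ {e} → OnContour e → ¬ IntoW₁ e → IntoW₁ (next e)
                        → ∃ λ h → Bottom h × Walk Shore (target e) h
    walk-to-bottom-from {e} on away into′ with edges-into-w₁ (next-onContour on) into′
    ... | inj₁ next≡e₀ with L (below 0) in below₀ | L (below 1) in below₁
    ...   | blue | blue with refl ← trans (prev-of on next≡e₀) (follow-turn rot⁻¹ below₀) =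
      below 1 , inj₁ refl , step (target-shore {onLine 0 , S} on away) E refl (here below₁-shore)
      where
      below₁-shore : Shore (below 1)
      below₁-shore = below₁ , (λ ()) , (λ ()) , onLine 0 , a∈A , S , inj₂ refl
    ...   | blue | red  = ⊥-elim (clash (below₀-red below₁) below₀)
    ...   | red  | blue with refl ← trans (prev-of on next≡e₀) (follow-straight rot⁻¹ below₀ below₁) =
      below 1 , inj₁ refl , here (target-shore {below 0 , E} on away)
    ...   | red  | red  =
      ⊥-elim (away (cong target (trans (prev-of on next≡e₀) (follow-corner rot⁻¹ below₀ below₁))))
    walk-to-bottom-from {e} on away into′ | inj₂ (inj₁ next≡σ₁) =
      ⊥-elim (away (cong target (trans (prev-of on next≡σ₁)
                                       (follow-corner rot⁻¹ (above₀-red (A-red above₁∈A)) (A-red a∈A)))))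
      where
      above₁∈A : A (above 1)
      above₁∈A = proj₁ (subst OnContour next≡σ₁ (next-onContour on))
    walk-to-bottom-from {e} on away into′ | inj₂ (inj₂ next≡σ₂) with L (below 2) in below₂
    ... | red  = ⊥-elim (below₂∉A (A-closed E below₁∈A below₂))
      where
      below₁∈A : A (below 1)
      below₁∈A = proj₁ (subst OnContour next≡σ₂ (next-onContour on))
    ... | blue with refl ← trans (prev-of on next≡σ₂) (follow-turn rot⁻¹ below₂) =
      below 2 , inj₂ refl , here (target-shore {below 1 , E} on away)

    walk-to-bottom : ∀ n {e} → OnContour e → ¬ IntoW₁ e → IntoW₁ (iterate next e n)
                   → ∃ λ h → Bottom h × Walk Shore (target e) h
    walk-to-bottom zero        on away into = ⊥-elim (away into)
    walk-to-bottom (suc n) {e} on away into with intoW₁? (next e)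
    ... | yes into′ = walk-to-bottom-from on away into′
    ... | no away′ with walk-to-bottom n (next-onContour on) away′ into
    ...   | h , bottom , walk = h , bottom , walk-step on away away′ ++ʷ walk

    TopToBottom : Set
    TopToBottom = ∃ λ h → Top h × ∃ λ h′ → Bottom h′ × Walk Shore h h′

    walk-via : ∀ {h} e → Top h → Walk Shore h (target e) → OnContour e → ¬ IntoW₁ e
             → ∀ n → IntoW₁ (iterate next e n) → TopToBottom
    walk-via {h} e top walk on away n into with walk-to-bottom n on away into
    ... | h′ , bottom , walk′ = h , top , h′ , bottom , walk ++ʷ walk′

    period : ℕ
    period = proj₁ (next-periodic index index-injective {e₀} (a∈A , w₁-blue))

    e₀-returns : iterate next e₀ (suc period) ≡ e₀
    e₀-returns = proj₂ (next-periodic index index-injective (a∈A , w₁-blue))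

    into-w₁-after : ∀ e k {e′} → iterate next e (suc k) ≡ e₀ → next e ≡ e′ → IntoW₁ (iterate next e′ k)
    into-w₁-after _ _ returns refl = cong target returns

    top-to-bottom : TopToBottom
    top-to-bottom with L (above 0) in above₀ | L (above 1) in above₁
    ... | blue | _    =
      walk-via (onLine 0 , N) (inj₁ refl) (step above₁-shore W refl (here (target-shore {onLine 0 , N} on (λ ()))))
          on (λ ()) period (into-w₁-after e₀ period e₀-returns (follow-turn rot above₀))
      where
      on : OnContour (onLine 0 , N)
      on = a∈A , above₀
      above₁-shore : Shore (above 1)
      above₁-shore = cross-free E a∈A w₁-blue above₀ , (λ ()) , (λ ()) , onLine 0 , a∈A , E , inj₂ refl
    ... | red  | blue =
      walk-via (above 0 , E) (inj₁ refl) (here (target-shore {above 0 , E} on (λ ())))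
          on (λ ()) period (into-w₁-after e₀ period e₀-returns (follow-straight rot above₀ above₁))
      where
      on : OnContour (above 0 , E)
      on = A-closed N a∈A above₀ , above₁
    ... | red  | red  with L (above 2) in above₂
    ...   | red = ⊥-elim (above₂∉A (A-closed E (A-closed E (A-closed N a∈A above₀) above₁) above₂))
    ...   | blue with period | e₀-returns
    ...     | zero  | returns′ with () ← trans (sym (follow-corner rot above₀ above₁)) returns′
    ...     | suc k | returns′ =
      walk-via (above 1 , E) (inj₂ refl) (here (target-shore {above 1 , E} on (λ ())))
          on (λ ()) k (into-w₁-after (next e₀) k returns′
                        (trans (cong next (follow-corner rot above₀ above₁)) (follow-turn rot above₂)))
      where
      on : OnContour (above 1 , E)
      on = A-closed E (A-closed N a∈A above₀) above₁ , above₂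

module Grid {m n : ℕ} where

  ι : V m n → Point
  ι u = + row u , + col u

  same-vertex : ∀ {u v : V m n} → row u ≡ row v → col u ≡ col v → u ≡ v
  same-vertex r c = cong₂ _,_ (Fin.toℕ-injective r) (Fin.toℕ-injective c)

  ι-injective : ∀ {u v} → ι u ≡ ι v → u ≡ v
  ι-injective eq with ,-injective eq
  ... | r , c = same-vertex (ℤ.+-injective r) (ℤ.+-injective c)

  _≟ⱽ_ : (u v : V m n) → Dec (u ≡ v)
  _≟ⱽ_ = ≡-dec Fin._≟_ Fin._≟_

  Step : Dir → V m n → V m n → Set
  Step d u v = ι v ≡ move d (ι u)

  Step-target : ∀ {d u v v′} → Step d u v → Step d u v′ → v ≡ v′
  Step-target s s′ = ι-injective (trans s (sym s′))

  Step-source : ∀ {d u u′ v} → Step d u v → Step d u′ v → u ≡ u′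
  Step-source {d} s s′ = ι-injective (trans (move⁻¹ d (sym s)) (sym (move⁻¹ d (sym s′))))

  Line : Dir → V m n → V m n → V m n → V m n → Set
  Line D a w₁ w₂ b = Step D a w₁ × Step D w₁ w₂ × Step D w₂ b

  Step-E : ∀ {u v} → row v ≡ row u → col v ≡ suc (col u) → Step E u v
  Step-E r c = cong₂ _,_ (cong +_ r) (cong +_ c)

  Step-S : ∀ {u v} → row v ≡ suc (row u) → col v ≡ col u → Step S u v
  Step-S r c = cong₂ _,_ (cong +_ r) (cong +_ c)

  Step-E⁻¹ : ∀ {u v} → Step E u v → row v ≡ row u × col v ≡ suc (col u)
  Step-E⁻¹ s with ,-injective s
  ... | r , c = ℤ.+-injective r , ℤ.+-injective c

  Step-S⁻¹ : ∀ {u v} → Step S u v → row v ≡ suc (row u) × col v ≡ col u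
  Step-S⁻¹ s with ,-injective s
  ... | r , c = ℤ.+-injective r , ℤ.+-injective c

  pred-injective : ∀ {a b} → + a ≡ ℤ.pred (+ b) → suc a ≡ b
  pred-injective {a} {b} eq = ℤ.+-injective (trans (cong ℤ.suc eq) (ℤ.suc-pred (+ b)))

  Step⇒Adj : ∀ d {u v} → Step d u v → Adj u v
  Step⇒Adj E s with Step-E⁻¹ s
  ... | r , c = inj₁ (sym r , inj₁ (sym c))
  Step⇒Adj S s with Step-S⁻¹ s
  ... | r , c = inj₂ (sym c , inj₁ (sym r))
  Step⇒Adj W s with ,-injective s
  ... | r , c = inj₁ (sym (ℤ.+-injective r) , inj₂ (pred-injective c))
  Step⇒Adj N s with ,-injective s
  ... | r , c = inj₂ (sym (ℤ.+-injective c) , inj₂ (pred-injective r))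

  Adj⇒Step : ∀ {u v} → Adj u v → ∃ λ d → Step d u v
  Adj⇒Step (inj₁ (r , inj₁ c)) = E , Step-E (sym r) (sym c)
  Adj⇒Step (inj₁ (r , inj₂ c)) = W , cong₂ _,_ (cong +_ (sym r)) (cong (ℤ.pred ∘ +_) c)
  Adj⇒Step (inj₂ (c , inj₁ r)) = S , Step-S (sym r) (sym c)
  Adj⇒Step (inj₂ (c , inj₂ r)) = N , cong₂ _,_ (cong (ℤ.pred ∘ +_) r) (cong +_ (sym c))

  Adj-sym : ∀ {u v : V m n} → Adj u v → Adj v u
  Adj-sym (inj₁ (r , c)) = inj₁ (sym r , swap c)
  Adj-sym (inj₂ (c , r)) = inj₂ (sym c , swap r)

  module _ {P : V m n → Set} where

    reach-head : ∀ {u v} → Reach P u v → P u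
    reach-head (here p)     = p
    reach-head (step p _ _) = p

    reach-last : ∀ {u v} → Reach P u v → P v
    reach-last (here p)     = p
    reach-last (step _ _ r) = reach-last r

    _++ᴿ_ : ∀ {u v w} → Reach P u v → Reach P v w → Reach P u w
    here _       ++ᴿ r′ = r′
    step p adj r ++ᴿ r′ = step p adj (r ++ᴿ r′)

    reach-snoc : ∀ {u v w} → Reach P u v → Adj v w → P w → Reach P u w
    reach-snoc r adj p = r ++ᴿ step (reach-last r) adj (here p)

    reach-reverse : ∀ {u v} → Reach P u v → Reach P v u
    reach-reverse (here p)       = here p
    reach-reverse (step p adj r) = reach-snoc (reach-reverse r) (Adj-sym adj) p

  first-entry : ∀ {P X : V m n → Set} → Decidable X → ∀ {u t} → Reach P u t → X t → ¬ X u
              → ∃ λ v → Reach (λ x → P x × ¬ X x) u v × ∃ λ x → X x × Adj v x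
  first-entry X? (here _) t∈X u∉X = ⊥-elim (u∉X t∈X)
  first-entry X? {u} (step {v = v} p adj r) t∈X u∉X with X? v
  ... | yes v∈X = u , here (p , u∉X) , v , v∈X , adj
  ... | no  v∉X with first-entry X? r t∈X v∉X
  ...   | v′ , r′ , x , x∈X , adj′ = v′ , step (p , u∉X) adj r′ , x , x∈X , adj′

  reach-map : ∀ {P Q : V m n → Set} → (∀ {x} → P x → Q x) → ∀ {u v} → Reach P u v → Reach Q u v
  reach-map f (here p)       = here (f p)
  reach-map f (step p adj r) = step (f p) adj (reach-map f r)

  Interior : V m n → Set
  Interior u = ¬ OnBoundary u

  near1-coordinate : ∀ {k} (i : Fin k) → toℕ i ≢ 0 → suc (toℕ i) ≢ k
                   → ∀ {x} → Near1 (+ toℕ i) x → ∃ λ (j : Fin k) → + toℕ j ≡ x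
  near1-coordinate i _ _ (inj₂ (inj₁ refl)) = i , refl
  near1-coordinate {k} i _ last (inj₂ (inj₂ refl)) =
    fromℕ< i+1<k , cong +_ (Fin.toℕ-fromℕ< i+1<k)
    where
    i+1<k : suc (toℕ i) ℕ.< k
    i+1<k = ℕ.≤∧≢⇒< (Fin.toℕ<n i) last
  near1-coordinate {k} i first _ (inj₁ refl) with toℕ i | Fin.toℕ<n i
  ... | zero  | _   = ⊥-elim (first refl)
  ... | suc r | i<k = fromℕ< r<k , cong +_ (Fin.toℕ-fromℕ< r<k)
    where
    r<k : r ℕ.< k
    r<k = ℕ.<-trans (ℕ.n<1+n r) i<k

  interior-box : ∀ u → Interior u → ∀ z → Box (ι u) z → ∃ λ v → ι v ≡ z
  interior-box (i , j) int _ (near-x , near-y)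
    with near1-coordinate i (int ∘ inj₁) (int ∘ inj₂ ∘ inj₁) near-x
       | near1-coordinate j (int ∘ inj₂ ∘ inj₂ ∘ inj₁) (int ∘ inj₂ ∘ inj₂ ∘ inj₂) near-y
  ... | i′ , refl | j′ , refl = (i′ , j′) , refl

  neighbor : ∀ {u} → Interior u → ∀ d → ∃ λ v → Step d u v
  neighbor {u} int d = interior-box u int _ (move-box d (ι u))

  diagonal : ∀ {u} → Interior u → ∀ d → ∃ λ v → ι v ≡ move (rot d) (move d (ι u))
  diagonal {u} int d = interior-box u int _ (diagonal-box d (ι u))

  Step-back : ∀ d {u v} → Step d u v → Step (opp d) v u
  Step-back d s = move⁻¹ d (sym s)

  Line-reverse : ∀ {D a w₁ w₂ b} → Line D a w₁ w₂ b → Line (opp D) b w₂ w₁ a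
  Line-reverse {D} (a-w₁ , w₁-w₂ , w₂-b) = Step-back D w₂-b , Step-back D w₁-w₂ , Step-back D a-w₁

  Step-parallelogram : ∀ d e {u v w x} → Step d u v → Step e v w → Step e u x → Step d x w
  Step-parallelogram d e {u} uv vw ux =
    trans vw (trans (cong (move e) uv) (trans (move-comm e d (ι u)) (cong (move d) (sym ux))))

module Colored {m n : ℕ} (c : Coloring m n) where
  open Grid

  -- Off the grid the color is arbitrary: only cells within distance one of an island get inspected.
  extend : Point → Color
  extend (+ r , + s) with r ℕ.<? m | s ℕ.<? n
  ... | yes r<m | yes s<n = c (fromℕ< r<m , fromℕ< s<n)
  ... | _       | _       = blue
  extend _ = blue

  extend-ι : ∀ u → extend (ι u) ≡ c u
  extend-ι (i , j) with toℕ i ℕ.<? m | toℕ j ℕ.<? n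
  ... | yes i<m | yes j<n = cong₂ (λ i′ j′ → c (i′ , j′)) (Fin.fromℕ<-toℕ i i<m) (Fin.fromℕ<-toℕ j j<n)
  ... | no i≮m  | _       = ⊥-elim (i≮m (Fin.toℕ<n i))
  ... | yes _   | no j≮n  = ⊥-elim (j≮n (Fin.toℕ<n j))

  extend-at : ∀ {v z} → ι v ≡ z → extend z ≡ c v
  extend-at {v} refl = extend-ι v

  square-cross : ∀ {p q r s} → Step S p q → Step E p r → Step E q s
               → c p ≡ c s → c q ≡ c r → c p ≢ c q → HasCross c
  square-cross {p} {q} {r} {s} pq pr qs ps qr p≢q with Step-S⁻¹ pq | Step-E⁻¹ pr | Step-E⁻¹ qs
  ... | row-q , col-q | row-r , col-r | row-s , col-s =
    p , q , r , s , (row-q , col-q) , (row-r , col-r) , (trans row-s row-q , trans col-s (cong suc col-q)) ,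
    ps , qr , p≢q

  same-color : ∀ {x y k} → c x ≡ k → c y ≡ k → c x ≡ c y
  same-color cx cy = trans cx (sym cy)

  blue≢red : ∀ {x y} → c x ≡ blue → c y ≡ red → c x ≢ c y
  blue≢red cx cy eq with () ← trans (sym cy) (trans (sym eq) cx)

  red≢blue : ∀ {x y} → c x ≡ red → c y ≡ blue → c x ≢ c y
  red≢blue cx cy eq = blue≢red cy cx (sym eq)

  diagonal-cross : ∀ e {u q r s} → Step e u q → Step (rot e) u r → Step (rot e) q s
                 → c u ≡ red → c q ≡ blue → c r ≡ blue → c s ≡ red → HasCross c
  diagonal-cross E uq ur qs u-red q-blue r-blue s-red =
    square-cross (Step-back N ur) (Step-parallelogram E N uq qs ur) uq
                 (same-color r-blue q-blue) (same-color u-red s-red) (blue≢red r-blue u-red)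
  diagonal-cross N uq ur qs u-red q-blue r-blue s-red =
    square-cross (Step-back N (Step-parallelogram N W uq qs ur)) (Step-back W qs) (Step-back W ur)
                 (same-color s-red u-red) (same-color r-blue q-blue) (red≢blue s-red r-blue)
  diagonal-cross W uq ur qs u-red q-blue r-blue s-red =
    square-cross qs (Step-back W uq) (Step-parallelogram E S (Step-back W uq) ur qs)
                 (same-color q-blue r-blue) (same-color s-red u-red) (blue≢red q-blue s-red)
  diagonal-cross S uq ur qs u-red q-blue r-blue s-red =
    square-cross uq ur qs (same-color u-red s-red) (same-color q-blue r-blue) (red≢blue u-red q-blue)

  cross-free-at : ¬ HasCross c → ∀ {u} → Interior u → c u ≡ red → ∀ e
                → extend (move e (ι u)) ≡ blue → extend (move (rot e) (ι u)) ≡ blue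
                → extend (move (rot e) (move e (ι u))) ≡ blue
  cross-free-at no-cross {u} int u-red e q-blue r-blue
    with neighbor {u = u} int e | neighbor {u = u} int (rot e) | diagonal {u = u} int e
  ... | q , uq | r , ur | s , us with c s in s-color
  ... | blue = trans (extend-at us) s-color
  ... | red  = ⊥-elim (no-cross (diagonal-cross e uq ur (trans us (cong (move (rot e)) (sym uq))) u-red
                                   (trans (sym (extend-at uq)) q-blue) (trans (sym (extend-at ur)) r-blue) s-color))

module Island {m n : ℕ} (c : Coloring m n) (no-cross : ¬ HasCross c)
  {o o′ w w′ : V m n} (D : Dir) (line : Grid.Line D o w w′ o′)
  (o-red : c o ≡ red) (o′-red : c o′ ≡ red) (w-blue : c w ≡ blue) (w′-blue : c w′ ≡ blue)
  (island : IsIsland c o) (apart : ¬ Region c o o′)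
  where
  open Grid
  open Colored c

  G : Point → Point
  G = frame D (ι o)

  At : V m n → Point → Set
  At v z = ι v ≡ G z

  at-injective : ∀ {v z z′} → At v z → At v z′ → z ≡ z′
  at-injective at at′ = frame-injective D (ι o) (trans (sym at) at′)

  G-move : ∀ {v z} d → At v z → G (move d z) ≡ move (turn D d) (ι v)
  G-move {z = z} d at = trans (frame-move D (ι o) d z) (cong (move (turn D d)) (sym at))

  G-corner : ∀ {v z} d → At v z → G (move (rot d) (move d z)) ≡ move (rot (turn D d)) (move (turn D d) (ι v))
  G-corner {z = z} d at = trans (frame-move D (ι o) (rot d) (move d z)) (cong₂ move (turn-rot D d) (G-move d at))

  at-step : ∀ {v v′ z} d → At v z → Step (turn D d) v v′ → At v′ (move d z)
  at-step d at s = trans s (sym (G-move d at))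

  step-at : ∀ {v v′ z} d → At v z → At v′ (move d z) → Step (turn D d) v v′
  step-at d at at′ = trans at′ (G-move d at)

  at-line : ∀ {v v′ z} → At v z → Step D v v′ → At v′ (move E z)
  at-line at s = at-step E at (subst (λ d → Step d _ _) (sym (turn-E D)) s)

  at-o : At o (onLine 0)
  at-o = sym (frame-origin D (ι o))

  at-w : At w (onLine 1)
  at-w = at-line at-o (proj₁ line)

  at-w′ : At w′ (onLine 2)
  at-w′ = at-line at-w (proj₁ (proj₂ line))

  at-o′ : At o′ (onLine 3)
  at-o′ = at-line at-w′ (proj₂ (proj₂ line))

  L : Point → Color
  L z = extend (G z)

  A : Point → Set
  A z = Σ (V m n) λ u → Region c o u × At u z

  A-red : ∀ {z} → A z → L z ≡ red
  A-red (u , R , at) = trans (extend-at at) (trans (reach-last R) o-red)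

  A-closed : ∀ {z} d → A z → L (move d z) ≡ red → A (move d z)
  A-closed d (u , R , at) red′ with neighbor (island u R) (turn D d)
  ... | v , uv = v , reach-snoc R (Step⇒Adj _ uv) (trans (sym (extend-at at′)) (trans red′ (sym o-red))) , at′
    where
    at′ : At v (move d _)
    at′ = at-step d at uv

  A-cross-free : ∀ {z} d → A z → L (move d z) ≡ blue → L (move (rot d) z) ≡ blue
               → L (move (rot d) (move d z)) ≡ blue
  A-cross-free d (u , R , at) blue₁ blue₂ =
    trans (cong extend (G-corner d at))
      (cross-free-at no-cross (island u R) (trans (reach-last R) o-red) (turn D d)
        (trans (cong extend (sym (G-move d at))) blue₁)
        (trans (cong extend (sym (trans (G-move (rot d) at) (cong (λ e → move e (ι u)) (turn-rot D d)))))
               blue₂))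

  index : ∀ {z} → A z → Fin (m ℕ.* n)
  index ((i , j) , _) = Fin.combine i j

  index-injective : ∀ {z z′} (p : A z) (p′ : A z′) → index p ≡ index p′ → z ≡ z′
  index-injective ((i , j) , _ , at) ((i′ , j′) , _ , at′) eq
    with Fin.combine-injective i j i′ j′ eq
  ... | refl , refl = at-injective at at′

  o′∉A : ¬ A (onLine 3)
  o′∉A (u , R , at) with ι-injective (trans at (sym at-o′))
  ... | refl = apart R

  open Contour L A A-red A-closed A-cross-free
  open Separation index index-injective (o , here refl , at-o) (trans (extend-at at-w) w-blue)
    (trans (extend-at at-w′) w′-blue) (trans (extend-at at-o′) o′-red) o′∉A

  Avoiding : V m n → Set
  Avoiding x = c x ≡ blue × ¬ (x ≡ w ⊎ x ≡ w′)

  shore-vertex : ∀ {z} → Shore z → ∃ λ v → At v z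
  shore-vertex (_ , _ , _ , _ , (u₀ , R , at) , d , inj₁ refl) with neighbor (island u₀ R) (turn D d)
  ... | v , uv = v , at-step d at uv
  shore-vertex (_ , _ , _ , u , (u₀ , R , at) , d , inj₂ refl) with diagonal (island u₀ R) (turn D d)
  ... | v , diag = v , trans diag (sym (G-corner d at))

  shore-avoiding : ∀ {v z} → Shore z → At v z → Avoiding v
  shore-avoiding (z-blue , z≢w , z≢w′ , _) at =
    trans (sym (extend-at at)) z-blue ,
    [ (λ { refl → z≢w (at-injective at at-w) }) , (λ { refl → z≢w′ (at-injective at at-w′) }) ]′

  walk⇒reach : ∀ {z z′ v v′} → Walk Shore z z′ → At v z → At v′ z′ → Reach Avoiding v v′
  walk⇒reach (here s) at at′ with ι-injective (trans at (sym at′))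
  ... | refl = here (shore-avoiding s at)
  walk⇒reach (step s d refl rest) at at′ with shore-vertex (walk-head rest)
  ... | v₁ , at₁ = step (shore-avoiding s at) (Step⇒Adj _ (step-at d at at₁)) (walk⇒reach rest at₁ at′)

  close-reach : ∀ {v v′ z z′} → Avoiding v → Avoiding v′ → At v z → At v′ z′
              → z ≡ z′ ⊎ ∃ (λ d → z′ ≡ move d z) → Reach Avoiding v v′
  close-reach av _ at at′ (inj₁ refl) with ι-injective (trans at (sym at′))
  ... | refl = here av
  close-reach av av′ at at′ (inj₂ (d , refl)) = step av (Step⇒Adj _ (step-at d at at′)) (here av′)

  w-neighbor : ∀ {v x} → Adj v x → x ≡ w ⊎ x ≡ w′ → Avoiding v → ∃ λ z → At v z × (Top z ⊎ Bottom z)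
  w-neighbor {v} adj x∈W (v-blue , v∉W) with Adj⇒Step (Adj-sym adj)
  ... | e , xv with turn-surjective D e
  ...   | d , refl = around d x∈W xv
    where
    around : ∀ d {x} → x ≡ w ⊎ x ≡ w′ → Step (turn D d) x v → ∃ λ z → At v z × (Top z ⊎ Bottom z)
    around E (inj₁ refl) xv with ι-injective (trans (at-step E at-w xv) (sym at-w′))
    ... | refl = ⊥-elim (v∉W (inj₂ refl))
    around N (inj₁ refl) xv = above 1 , at-step N at-w xv , inj₁ (inj₁ refl)
    around W (inj₁ refl) xv with ι-injective (trans (at-step W at-w xv) (sym at-o))
    ... | refl = ⊥-elim (blue≢red v-blue o-red refl)
    around S (inj₁ refl) xv = below 1 , at-step S at-w xv , inj₂ (inj₁ refl)
    around E (inj₂ refl) xv with ι-injective (trans (at-step E at-w′ xv) (sym at-o′))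
    ... | refl = ⊥-elim (blue≢red v-blue o′-red refl)
    around N (inj₂ refl) xv = above 2 , at-step N at-w′ xv , inj₁ (inj₂ refl)
    around W (inj₂ refl) xv with ι-injective (trans (at-step W at-w′ xv) (sym at-w))
    ... | refl = ⊥-elim (v∉W (inj₁ refl))
    around S (inj₂ refl) xv = below 2 , at-step S at-w′ xv , inj₂ (inj₂ refl)

  hub : ∃ λ H → ∀ {v z} → Avoiding v → At v z → Top z ⊎ Bottom z → Reach Avoiding v H
  hub with top-to-bottom
  ... | h , top , h′ , bottom , walk with shore-vertex (walk-head walk) | shore-vertex (walk-last walk)
  ...   | H , at-H | H′ , at-H′ = H , reaches
    where
    H⇝H′ : Reach Avoiding H H′
    H⇝H′ = walk⇒reach walk at-H at-H′
    reaches : ∀ {v z} → Avoiding v → At v z → Top z ⊎ Bottom z → Reach Avoiding v H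
    reaches av at (inj₁ top-z) = close-reach av (reach-head H⇝H′) at at-H (Flank-close top-z top)
    reaches av at (inj₂ bottom-z) =
      close-reach av (reach-last H⇝H′) at at-H′ (Flank-close bottom-z bottom) ++ᴿ reach-reverse H⇝H′

  reaches-hub : ∀ {u} → Reach (λ x → c x ≡ blue) w u → Avoiding u → Reach Avoiding u (proj₁ hub)
  reaches-hub w⇝u (_ , u∉W)
    with first-entry (λ x → (x ≟ⱽ w) ⊎-dec (x ≟ⱽ w′)) (reach-reverse w⇝u) (inj₁ refl) u∉W
  ... | v , u⇝v , x , x∈W , adj with w-neighbor adj x∈W (reach-last u⇝v)
  ...   | z , at , flank = u⇝v ++ᴿ proj₂ hub (reach-last u⇝v) at flank

  avoiding-connected : ∀ {u v} → Reach (λ x → c x ≡ blue) w u → Reach (λ x → c x ≡ blue) w v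
                     → Avoiding u → Avoiding v → Reach Avoiding u v
  avoiding-connected w⇝u w⇝v au av = reaches-hub w⇝u au ++ᴿ reach-reverse (reaches-hub w⇝v av)

module Recoloring {m n : ℕ} (c : Coloring m n) (w₁ w₂ : V m n) where
  open Grid

  c′ : Coloring m n
  c′ = recolorRed c w₁ w₂

  Untouched : V m n → Set
  Untouched x = ¬ (x ≡ w₁ ⊎ x ≡ w₂)

  recolored : ∀ {x} → x ≡ w₁ ⊎ x ≡ w₂ → c′ x ≡ red
  recolored (inj₁ refl) rewrite ℕ.≟-diag (refl {x = row w₁}) | ℕ.≟-diag (refl {x = col w₁}) = refl
  recolored (inj₂ refl) with row w₂ ℕ.≟ row w₁ | col w₂ ℕ.≟ col w₁
  ... | yes _ | yes _ = refl
  ... | no _  | _     rewrite ℕ.≟-diag (refl {x = row w₂}) | ℕ.≟-diag (refl {x = col w₂}) = refl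
  ... | yes _ | no _  rewrite ℕ.≟-diag (refl {x = row w₂}) | ℕ.≟-diag (refl {x = col w₂}) = refl

  recolor-other : ∀ {x} → Untouched x → c′ x ≡ c x
  recolor-other {x} x∉W with row x ℕ.≟ row w₁ | col x ℕ.≟ col w₁ | row x ℕ.≟ row w₂ | col x ℕ.≟ col w₂
  ... | yes r | yes c | _     | _     = ⊥-elim (x∉W (inj₁ (same-vertex r c)))
  ... | no _  | _     | yes r | yes c = ⊥-elim (x∉W (inj₂ (same-vertex r c)))
  ... | yes _ | no _  | yes r | yes c = ⊥-elim (x∉W (inj₂ (same-vertex r c)))
  ... | no _  | _     | no _  | _     = refl
  ... | no _  | _     | yes _ | no _  = refl
  ... | yes _ | no _  | no _  | _     = refl
  ... | yes _ | no _  | yes _ | no _  = refl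

  recolor-keeps-red : ∀ {x} → c x ≡ red → c′ x ≡ red
  recolor-keeps-red {x} x-red with (x ≟ⱽ w₁) ⊎-dec (x ≟ⱽ w₂)
  ... | yes x∈W = recolored x∈W
  ... | no  x∉W = trans (recolor-other x∉W) x-red

  module _ {D : Dir} {a b : V m n} (line : Line D a w₁ w₂ b) (a-red : c a ≡ red) (b-red : c b ≡ red) where

    red-after : ∀ {x y} → x ≡ w₁ ⊎ x ≡ w₂ → Step D x y → c′ y ≡ red
    red-after (inj₁ refl) xy with Step-target xy (proj₁ (proj₂ line))
    ... | refl = recolored (inj₂ refl)
    red-after (inj₂ refl) xy with Step-target xy (proj₂ (proj₂ line))
    ... | refl = recolor-keeps-red b-red

    red-before : ∀ {x y} → y ≡ w₁ ⊎ y ≡ w₂ → Step D x y → c′ x ≡ red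
    red-before (inj₁ refl) xy with Step-source xy (proj₁ line)
    ... | refl = recolor-keeps-red a-red
    red-before (inj₂ refl) xy with Step-source xy (proj₁ (proj₂ line))
    ... | refl = recolored (inj₁ refl)

    untouched-pair : ∀ {x y} → Step D x y → c′ x ≢ c′ y → Untouched x × Untouched y
    untouched-pair xy x≢y =
      (λ x∈W → x≢y (trans (recolored x∈W) (sym (red-after x∈W xy)))) ,
      (λ y∈W → x≢y (trans (red-before y∈W xy) (sym (recolored y∈W))))

  untouched-colors : ∀ {p q r s} → Untouched p → Untouched q → Untouched r → Untouched s
                   → c′ p ≡ c′ s → c′ q ≡ c′ r → c′ p ≢ c′ q → c p ≡ c s × c q ≡ c r × c p ≢ c q
  untouched-colors p∉W q∉W r∉W s∉W ps qr p≢q =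
    trans (sym (recolor-other p∉W)) (trans ps (recolor-other s∉W)) ,
    trans (sym (recolor-other q∉W)) (trans qr (recolor-other r∉W)) ,
    λ eq → p≢q (trans (recolor-other p∉W) (trans eq (sym (recolor-other q∉W))))

  -- Along the line, the square of a cross consists of two pairs of neighbors of different colors.
  recolor-cross-free : ∀ {D a b} → D ≡ E ⊎ D ≡ S → Line D a w₁ w₂ b → c a ≡ red → c b ≡ red
                     → ¬ HasCross c → ¬ HasCross c′
  recolor-cross-free (inj₁ refl) line a-red b-red no-cross
    (p , q , r , s , p-q@(rq , cq) , p-r@(rr , cr) , p-s@(rs , cs) , ps , qr , p≢q)
    with untouched-pair {E} line a-red b-red (Step-E rr cr) (λ eq → p≢q (trans eq (sym qr)))
       | untouched-pair {E} line a-red b-red (Step-E (trans rs (sym rq)) (trans cs (cong suc (sym cq))))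
                                         (λ eq → p≢q (trans ps (sym eq)))
  ... | p∉W , r∉W | q∉W , s∉W =
    no-cross (p , q , r , s , p-q , p-r , p-s , untouched-colors p∉W q∉W r∉W s∉W ps qr p≢q)
  recolor-cross-free (inj₂ refl) line a-red b-red no-cross
    (p , q , r , s , p-q@(rq , cq) , p-r@(rr , cr) , p-s@(rs , cs) , ps , qr , p≢q)
    with untouched-pair {S} line a-red b-red (Step-S rq cq) p≢q
       | untouched-pair {S} line a-red b-red (Step-S (trans rs (cong suc (sym rr))) (trans cs (sym cr)))
                                         (λ eq → p≢q (trans ps (trans (sym eq) (sym qr))))
  ... | p∉W , q∉W | r∉W , s∉W =
    no-cross (p , q , r , s , p-q , p-r , p-s , untouched-colors p∉W q∉W r∉W s∉W ps qr p≢q)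

lineDiffs-cong : ∀ {k} {f g : Fin k → Color} → (∀ x → f x ≡ g x) → lineDiffs f ≡ lineDiffs g
lineDiffs-cong {zero}        _   = refl
lineDiffs-cong {suc zero}    _   = refl
lineDiffs-cong {suc (suc k)} f≗g =
  cong₂ ℕ._+_ (cong₂ bichrom (f≗g Fin.zero) (f≗g (Fin.suc Fin.zero))) (lineDiffs-cong (f≗g ∘ Fin.suc))

degOuter-boundary : ∀ {m n} {c c′ : Coloring m n} → (∀ u → OnBoundary u → c′ u ≡ c u)
                  → degOuter c′ ≡ degOuter c
degOuter-boundary {zero}              _  = refl
degOuter-boundary {suc m} {zero}      _  = refl
degOuter-boundary {suc m} {suc n} same =
  cong₂ ℕ._+_ (cong₂ ℕ._+_ (cong₂ ℕ._+_
    (lineDiffs-cong (λ j → same (Fin.zero , j) (inj₁ refl)))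
    (lineDiffs-cong (λ j → same (Fin.fromℕ m , j) (inj₂ (inj₁ (cong suc (Fin.toℕ-fromℕ m)))))))
    (lineDiffs-cong (λ i → same (i , Fin.zero) (inj₂ (inj₂ (inj₁ refl))))))
    (lineDiffs-cong (λ i → same (i , Fin.fromℕ n) (inj₂ (inj₂ (inj₂ (cong suc (Fin.toℕ-fromℕ n)))))))

module _ {m n : ℕ} where
  open Grid {m} {n}

  between-in-row : ∀ {x y z : V m n} → row y ≡ row x → row z ≡ row x → col x ℕ.< col y → col y ℕ.< col z
                 → OnBoundary y → OnBoundary x × OnBoundary z
  between-in-row ry rz _ _ (inj₁ top) = inj₁ (trans (sym ry) top) , inj₁ (trans rz (trans (sym ry) top))
  between-in-row ry rz _ _ (inj₂ (inj₁ bottom)) =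
    inj₂ (inj₁ (trans (cong suc (sym ry)) bottom)) , inj₂ (inj₁ (trans (cong suc (trans rz (sym ry))) bottom))
  between-in-row _ _ xy _ (inj₂ (inj₂ (inj₁ left))) = ⊥-elim (ℕ.n≮0 (subst (_ ℕ.<_) left xy))
  between-in-row {z = z} _ _ _ yz (inj₂ (inj₂ (inj₂ right))) =
    ⊥-elim (ℕ.<-irrefl right (ℕ.≤-<-trans yz (Fin.toℕ<n (proj₂ z))))

  between-in-column : ∀ {x y z : V m n} → col y ≡ col x → col z ≡ col x → row x ℕ.< row y → row y ℕ.< row z
                    → OnBoundary y → OnBoundary x × OnBoundary z
  between-in-column _ _ xy _ (inj₁ top) = ⊥-elim (ℕ.n≮0 (subst (_ ℕ.<_) top xy))
  between-in-column {z = z} _ _ _ yz (inj₂ (inj₁ bottom)) =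
    ⊥-elim (ℕ.<-irrefl bottom (ℕ.≤-<-trans yz (Fin.toℕ<n (proj₁ z))))
  between-in-column cy cz _ _ (inj₂ (inj₂ (inj₁ left))) =
    inj₂ (inj₂ (inj₁ (trans (sym cy) left))) , inj₂ (inj₂ (inj₁ (trans cz (trans (sym cy) left))))
  between-in-column cy cz _ _ (inj₂ (inj₂ (inj₂ right))) =
    inj₂ (inj₂ (inj₂ (trans (cong suc (sym cy)) right))) ,
    inj₂ (inj₂ (inj₂ (trans (cong suc (trans cz (sym cy))) right)))

  consecutive-between : ∀ {a w₁ w₂ b x : V m n} → Consecutive4 a w₁ w₂ b → x ≡ w₁ ⊎ x ≡ w₂
                      → OnBoundary x → OnBoundary a × OnBoundary b
  consecutive-between (inj₁ (r₁ , _ , r₃ , c₁ , _ , c₃)) (inj₁ refl) =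
    between-in-row r₁ r₃ (subst (_ ℕ.<_) (sym c₁) (ℕ.n<1+n _))
                         (subst₂ ℕ._<_ (sym c₁) (sym c₃) (ℕ.n≤1+n _))
  consecutive-between (inj₁ (_ , r₂ , r₃ , _ , c₂ , c₃)) (inj₂ refl) =
    between-in-row r₂ r₃ (subst (_ ℕ.<_) (sym c₂) (ℕ.n≤1+n _))
                         (subst₂ ℕ._<_ (sym c₂) (sym c₃) (ℕ.n<1+n _))
  consecutive-between (inj₂ (c₁ , _ , c₃ , r₁ , _ , r₃)) (inj₁ refl) =
    between-in-column c₁ c₃ (subst (_ ℕ.<_) (sym r₁) (ℕ.n<1+n _))
                            (subst₂ ℕ._<_ (sym r₁) (sym r₃) (ℕ.n≤1+n _))
  consecutive-between (inj₂ (_ , c₂ , c₃ , _ , r₂ , r₃)) (inj₂ refl) =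
    between-in-column c₂ c₃ (subst (_ ℕ.<_) (sym r₂) (ℕ.n≤1+n _))
                            (subst₂ ℕ._<_ (sym r₂) (sym r₃) (ℕ.n<1+n _))

  consecutive⇒line : ∀ {a w₁ w₂ b : V m n} → Consecutive4 a w₁ w₂ b
                   → ∃ λ D → (D ≡ E ⊎ D ≡ S) × Line D a w₁ w₂ b
  consecutive⇒line (inj₁ (r₁ , r₂ , r₃ , c₁ , c₂ , c₃)) =
    E , inj₁ refl , (Step-E r₁ c₁ , Step-E (trans r₂ (sym r₁)) (trans c₂ (cong suc (sym c₁))) ,
          Step-E (trans r₃ (sym r₂)) (trans c₃ (cong suc (sym c₂))))
  consecutive⇒line (inj₂ (c₁ , c₂ , c₃ , r₁ , r₂ , r₃)) =
    S , inj₂ refl , (Step-S r₁ c₁ , Step-S (trans r₂ (cong suc (sym r₁))) (trans c₂ (sym c₁)) ,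
          Step-S (trans r₃ (cong suc (sym r₂))) (trans c₃ (sym c₂)))

  recolor-degOuter : ∀ (c : Coloring m n) {a w₁ w₂ b} → Consecutive4 a w₁ w₂ b → IsIsland c a ⊎ IsIsland c b
                   → degOuter (recolorRed c w₁ w₂) ≡ degOuter c
  recolor-degOuter c {a} {w₁} {w₂} {b} consecutive island =
    degOuter-boundary λ u u-on → Recoloring.recolor-other c w₁ w₂ λ u∈W →
      [ (λ a-island → a-island a (here refl) (proj₁ (consecutive-between consecutive u∈W u-on))) ,
        (λ b-island → b-island b (here refl) (proj₂ (consecutive-between consecutive u∈W u-on))) ]′ island

  region-reach : ∀ {c : Coloring m n} {k v u u′} {Q : V m n → Set} → c v ≡ k → Region c v u
               → Reach (λ x → c x ≡ k × Q x) u u′ → Reach (λ x → Region c v x × Q x) u u′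
  region-reach _  R (here (_ , q))       = here (R , q)
  region-reach cv R (step (_ , q) adj r) =
    step (R , q) adj (region-reach cv (reach-snoc R adj (trans (proj₁ (reach-head r)) (sym cv))) r)

  module _ (c : Coloring m n) (no-cross : ¬ HasCross c)
           {a w₁ w₂ b : V m n} (D : Dir) (line : Line D a w₁ w₂ b)
           (a-red : c a ≡ red) (b-red : c b ≡ red) (w₁-blue : c w₁ ≡ blue) (w₂-blue : c w₂ ≡ blue)
           (apart : ¬ Region c a b) where

    w₁-w₂ : Step D w₁ w₂
    w₁-w₂ = proj₁ (proj₂ line)

    Avoiding : V m n → Set
    Avoiding x = c x ≡ blue × ¬ (x ≡ w₁ ⊎ x ≡ w₂)

    -- If b's region is the island, run the argument from b, walking the line backwards.
    avoiding-connected : IsIsland c a ⊎ IsIsland c b → ∀ {u v}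
                       → Reach (λ x → c x ≡ blue) w₁ u → Reach (λ x → c x ≡ blue) w₁ v
                       → Avoiding u → Avoiding v → Reach Avoiding u v
    avoiding-connected (inj₁ a-island) =
      Island.avoiding-connected c no-cross D line a-red b-red w₁-blue w₂-blue a-island apart
    avoiding-connected (inj₂ b-island) w₁⇝u w₁⇝v (u-blue , u∉W) (v-blue , v∉W) =
      reach-map (map₂ (_∘ swap))
        (Island.avoiding-connected c no-cross (opp D) (Line-reverse line)
           b-red a-red w₂-blue w₁-blue b-island apart′ (from-w₂ w₁⇝u) (from-w₂ w₁⇝v)
           (u-blue , u∉W ∘ swap) (v-blue , v∉W ∘ swap))
      where
      apart′ : ¬ Region c b a
      apart′ b⇝a = apart (reach-map (λ x-b → trans x-b (trans b-red (sym a-red))) (reach-reverse b⇝a))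
      from-w₂ : ∀ {u} → Reach (λ x → c x ≡ blue) w₁ u → Reach (λ x → c x ≡ blue) w₂ u
      from-w₂ = step w₂-blue (Adj-sym (Step⇒Adj D w₁-w₂))

    disposable : IsIsland c a ⊎ IsIsland c b → Disposable (Region c w₁) (λ u → u ≡ w₁ ⊎ u ≡ w₂)
    disposable island = contains , inj₂ connected
      where
      contains : ∀ u → u ≡ w₁ ⊎ u ≡ w₂ → Region c w₁ u
      contains _ (inj₁ refl) = here refl
      contains _ (inj₂ refl) = step refl (Step⇒Adj D w₁-w₂) (here (trans w₂-blue (sym w₁-blue)))
      blue-path : ∀ {u} → Region c w₁ u → Reach (λ x → c x ≡ blue) w₁ u
      blue-path = reach-map (λ x-w₁ → trans x-w₁ w₁-blue)
      connected : ∀ u v → Region c w₁ u × ¬ (u ≡ w₁ ⊎ u ≡ w₂) → Region c w₁ v × ¬ (v ≡ w₁ ⊎ v ≡ w₂)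
                → Reach (λ x → Region c w₁ x × ¬ (x ≡ w₁ ⊎ x ≡ w₂)) u v
      connected u v (w₁⇝u , u∉W) (w₁⇝v , v∉W) =
        region-reach w₁-blue w₁⇝u
          (avoiding-connected island (blue-path w₁⇝u) (blue-path w₁⇝v)
             (reach-last (blue-path w₁⇝u) , u∉W) (reach-last (blue-path w₁⇝v) , v∉W))

lemma22 : ∀ {m n} (c : Coloring m n) (a w₁ w₂ b : V m n)
    → ¬ HasCross c
    → Consecutive4 a w₁ w₂ b
    → c a ≡ red → c b ≡ red → c w₁ ≡ blue → c w₂ ≡ blue
    → ¬ Region c a b
    → IsIsland c a ⊎ IsIsland c b
    → Disposable (Region c w₁) (λ u → u ≡ w₁ ⊎ u ≡ w₂)
      × ¬ HasCross (recolorRed c w₁ w₂)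
      × degOuter (recolorRed c w₁ w₂) ≤ degOuter c
lemma22 c a w₁ w₂ b no-cross consecutive a-red b-red w₁-blue w₂-blue apart island =
  let D , horizontal-or-vertical , line = consecutive⇒line consecutive in
  disposable c no-cross D line a-red b-red w₁-blue w₂-blue apart island ,
  Recoloring.recolor-cross-free c w₁ w₂ horizontal-or-vertical line a-red b-red no-cross ,
  ℕ.≤-reflexive (recolor-degOuter c consecutive island)
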